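{- Let $Q$ be a positive integer. If there exists a positive integer $n$ with $S_{Qn}(Qn)\equiv n\pmod{Qn}$, then $Q$ is square-free.
   Context: For positive integers $m,k$, $S_m(k):=1^m+2^m+\cdots+k^m$. -}

module Defs where

open import Data.Nat using (ℕ; zero; suc; _+_; _*_; _^_)
open import Relation.Binary.PropositionalEquality using (_≡_)
open import Data.Nat.Divisibility using (_∣_)

S : ℕ → ℕ → ℕ
S m zero    = 0
S m (suc k) = S m k + suc k ^ m

SquareFree : ℕ → Set
SquareFree Q = ∀ d → d * d ∣ Q → d ≡ 1

open import Data.Integer as ℤ using (ℤ; +_)
import Data.Integer.Divisibility as ℤd

_≡_[mod_] : ℕ → ℕ → ℕ → Set
a ≡ b [mod m ] = (+ m) ℤd.∣ ((+ a) ℤ.- (+ b))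

{-# OPTIONS --safe #-}
module Submission where

-- Write Vₙ(K) = 0ⁿ + 1ⁿ + ⋯ + (K−1)ⁿ. Since (jm + i)ⁿ ≡ iⁿ (mod m), the
-- sum over [0, cm) is c copies of the sum over [0, m), so Vₙ(cm) ≡ c·Vₙ(m)
-- (mod m); iterating gives d^b ∣ Vₙ(m) whenever d^(b+1) ∣ m. Now let
-- d² ∣ Q and N = Qn. If d^e ∣ n then d^(e+2) ∣ N, hence d^(e+1) divides
-- S_N(N) = V_N(N) + N^N, and as d^(e+1) ∣ N ∣ S_N(N) − n, also d^(e+1) ∣ n.
-- So every power of d divides n ≥ 1, forcing d = 1.

open import Defs
open import Data.Nat using (ℕ; zero; suc; _+_; _*_; _^_; _≤_; _<_; z≤n; s≤s)
open import Data.Nat.Properties using (+-identityʳ; +-suc; +-assoc; *-mono-≤; *-zeroʳ; *-assoc; +-comm; n<1+n; ≤-<-trans; ^-monoʳ-<; 1+n≰n)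
open import Data.Nat.Divisibility
  using (_∣_; divides; 1∣_; ∣-refl; ∣-trans; 0∣⇒≡0; ∣m∣n⇒∣m+n; ∣m⇒∣m*n; m∣m*n; n∣m*n; *-monoʳ-∣; *-pres-∣; >⇒∤)
open import Data.Nat.Tactic.RingSolver using (solve-∀)
open import Data.Integer using (+_; _-_)
import Data.Integer.Tactic.RingSolver as ℤ
open import Data.Integer.Divisibility.Signed using (∣ᵤ⇒∣; ∣⇒∣ᵤ; ∣m∣n⇒∣m-n)
  renaming (_∣_ to _∣ℤ_; ∣-trans to ∣ℤ-trans)
open import Data.Product using (Σ-syntax; ∃-syntax; _×_; _,_)
open import Data.Empty using (⊥-elim)
open import Relation.Binary.PropositionalEquality using (_≡_; refl; sym; trans; cong; cong₂; subst; module ≡-Reasoning)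

∑ : ℕ → (ℕ → ℕ) → ℕ
∑ zero    f = 0
∑ (suc n) f = ∑ n f + f n

infix 5 ∑
syntax ∑ n (λ i → e) = ∑[ i < n ] e

∑-+ : ∀ a b f → ∑ (a + b) f ≡ ∑ a f + (∑[ i < b ] f (a + i))
∑-+ a zero    f rewrite +-identityʳ a = sym (+-identityʳ (∑ a f))
∑-+ a (suc b) f rewrite +-suc a b | ∑-+ a b f = +-assoc (∑ a f) _ _

infix 4 _≡_+*_

-- a ≡ b (mod m) with a ≥ b, kept in ℕ so that the ring solver applies.
_≡_+*_ : ℕ → ℕ → ℕ → Set
a ≡ b +* m = ∃[ y ] a ≡ b + m * y

∑-cong-+* : ∀ m n {f g} → (∀ i → f i ≡ g i +* m) → ∑ n f ≡ ∑ n g +* m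
∑-cong-+* m zero    f≡g = 0 , sym (*-zeroʳ m)
∑-cong-+* m (suc n) {f} {g} f≡g =
  let (y , ∑f≡) = ∑-cong-+* m n f≡g
      (z , f≡)  = f≡g n
  in y + z , (begin
    ∑ n f + f n                       ≡⟨ cong₂ _+_ ∑f≡ f≡ ⟩
    ∑ n g + m * y + (g n + m * z)     ≡⟨ regroup (∑ n g) (g n) m y z ⟩
    ∑ n g + g n + m * (y + z)         ∎)
  where
  open ≡-Reasoning
  regroup : ∀ a b m y z → a + m * y + (b + m * z) ≡ a + b + m * (y + z)
  regroup = solve-∀

^-cong-+* : ∀ N m j i → (j * m + i) ^ N ≡ i ^ N +* m
^-cong-+* zero    m j i = 0 , cong suc (sym (*-zeroʳ m))
^-cong-+* (suc N) m j i =
  let (y , ^≡) = ^-cong-+* N m j i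
  in j * i ^ N + i * y + j * m * y , (begin
    (j * m + i) * (j * m + i) ^ N     ≡⟨ cong ((j * m + i) *_) ^≡ ⟩
    (j * m + i) * (i ^ N + m * y)     ≡⟨ expand j m i (i ^ N) y ⟩
    i * i ^ N + m * (j * i ^ N + i * y + j * m * y) ∎)
  where
  open ≡-Reasoning
  expand : ∀ j m i p y → (j * m + i) * (p + m * y) ≡ i * p + m * (j * p + i * y + j * m * y)
  expand = solve-∀

powerSum : ℕ → ℕ → ℕ
powerSum N K = ∑[ k < K ] k ^ N

powerSum-*-+* : ∀ N m c → powerSum N (c * m) ≡ c * powerSum N m +* m
powerSum-*-+* N m zero    = 0 , sym (*-zeroʳ m)
powerSum-*-+* N m (suc c) =
  let (x , blocks≡) = powerSum-*-+* N m c
      (y , last≡)   = ∑-cong-+* m m (^-cong-+* N m c)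
  in x + y , (begin
    powerSum N (m + c * m)                             ≡⟨ cong (powerSum N) (+-comm m (c * m)) ⟩
    powerSum N (c * m + m)                             ≡⟨ ∑-+ (c * m) m (_^ N) ⟩
    powerSum N (c * m) + (∑[ i < m ] (c * m + i) ^ N)  ≡⟨ cong₂ _+_ blocks≡ last≡ ⟩
    c * V + m * x + (V + m * y)                        ≡⟨ regroup c V m x y ⟩
    V + c * V + m * (x + y)                            ∎)
  where
  open ≡-Reasoning
  V = powerSum N m
  regroup : ∀ c v m x y → c * v + m * x + (v + m * y) ≡ v + c * v + m * (x + y)
  regroup = solve-∀

powerSum-∣ : ∀ N d b {m} → d ^ suc b ∣ m → d ^ b ∣ powerSum N m
powerSum-∣ N d zero    _                = 1∣ _
powerSum-∣ N d (suc b) (divides c refl) =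
  let (x , V≡) = powerSum-*-+* N p (c * d)
  in subst (d ^ suc b ∣_) (sym (trans (cong (powerSum N) (sym (*-assoc c d p))) V≡))
       (∣m∣n⇒∣m+n (∣-trans d^[1+b]∣dV (divides c (*-assoc c d V))) (m∣m*n x))
  where
  p = d ^ suc b
  V = powerSum N p
  d^[1+b]∣dV : d ^ suc b ∣ d * V
  d^[1+b]∣dV = *-monoʳ-∣ d (powerSum-∣ N d b ∣-refl)

S≡powerSum : ∀ N K → S (suc N) K ≡ powerSum (suc N) (suc K)
S≡powerSum N zero    = refl
S≡powerSum N (suc K) = cong (_+ suc K ^ suc N) (S≡powerSum N K)

∣-resp-≡[mod] : ∀ {k m a b} → k ∣ m → a ≡ b [mod m ] → k ∣ a → k ∣ b
∣-resp-≡[mod] {k} {m} {a} {b} k∣m a≡b k∣a =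
  ∣⇒∣ᵤ (subst (+ k ∣ℤ_) (a-[a-b]≡b (+ a) (+ b))
    (∣m∣n⇒∣m-n (∣ᵤ⇒∣ {+ k} {+ a} k∣a) (∣ℤ-trans (∣ᵤ⇒∣ {+ k} {+ m} k∣m) (∣ᵤ⇒∣ {+ m} {+ a - + b} a≡b))))
  where
  a-[a-b]≡b : ∀ a b → a - (a - b) ≡ b
  a-[a-b]≡b = ℤ.solve-∀

d^[2+e]∣N⇒d^[1+e]∣n : ∀ {d e N n} → 1 ≤ N → d ^ suc (suc e) ∣ N → S N N ≡ n [mod N ] → d ^ suc e ∣ n
d^[2+e]∣N⇒d^[1+e]∣n {d} {e} {N@(suc N-1)} (s≤s z≤n) d^[2+e]∣N S≡n = ∣-resp-≡[mod] d^[1+e]∣N S≡n d^[1+e]∣S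
  where
  d^[1+e]∣N : d ^ suc e ∣ N
  d^[1+e]∣N = ∣-trans (n∣m*n d) d^[2+e]∣N
  d^[1+e]∣S : d ^ suc e ∣ S N N
  d^[1+e]∣S = subst (d ^ suc e ∣_) (sym (S≡powerSum N-1 N))
    (∣m∣n⇒∣m+n (powerSum-∣ N d (suc e) d^[2+e]∣N) (∣m⇒∣m*n _ d^[1+e]∣N))

n<m^n : ∀ {m} → 1 < m → ∀ n → n < m ^ n
n<m^n     1<m zero    = s≤s z≤n
n<m^n {m} 1<m (suc n) = ≤-<-trans (n<m^n 1<m n) (^-monoʳ-< m 1<m (n<1+n n))

∀[^∣]⇒≡0 : ∀ {d n} → 1 < d → (∀ e → d ^ e ∣ n) → n ≡ 0
∀[^∣]⇒≡0 {n = zero}  1<d d^∣n = refl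
∀[^∣]⇒≡0 {n = suc n} 1<d d^∣n = ⊥-elim (>⇒∤ (n<m^n 1<d (suc n)) (d^∣n (suc n)))

proposition2 : (Q : ℕ) → 1 ≤ Q →
    (Σ[ n ∈ ℕ ] (1 ≤ n × S (Q * n) (Q * n) ≡ n [mod Q * n ])) →
    SquareFree Q
proposition2 Q 1≤Q _               zero             0∣Q  = ⊥-elim (1+n≰n (subst (1 ≤_) (0∣⇒≡0 0∣Q) 1≤Q))
proposition2 Q 1≤Q _               (suc zero)       _    = refl
proposition2 Q 1≤Q (n , 1≤n , S≡n) d@(suc (suc _)) d²∣Q =
  ⊥-elim (1+n≰n (subst (1 ≤_) (∀[^∣]⇒≡0 (s≤s (s≤s z≤n)) d^e∣n) 1≤n))
  where
  d^e∣n : ∀ e → d ^ e ∣ n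
  d^e∣n zero    = 1∣ n
  d^e∣n (suc e) = d^[2+e]∣N⇒d^[1+e]∣n {d} {e} (*-mono-≤ 1≤Q 1≤n)
    (subst (_∣ Q * n) (*-assoc d d (d ^ e)) (*-pres-∣ d²∣Q (d^e∣n e))) S≡n
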